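{- Let $\mathsf{M}^* = \langle I, \{S_{\Phi}\}_{\Phi \subseteq \mathsf{At}}, (r^{\Phi}_{\Psi})_{\Psi \subseteq \Phi \subseteq \mathsf{At}}, (\Lambda^*_i)_{i \in I}, (\alpha_i)_{i \in I}, v \rangle$ be an implicit knowledge-based HMS model with derived explicit possibility correspondences $(\Pi^*_i)_{i \in I}$. Then $\langle I, \{S_{\Phi}\}_{\Phi \subseteq \mathsf{At}}, (r^{\Phi}_{\Psi})_{\Psi \subseteq \Phi \subseteq \mathsf{At}}, (\Lambda^*_i)_{i \in I}, (\Pi^*_i)_{i \in I}, v \rangle$ is a complemented HMS model and $\langle I, \{S_{\Phi}\}_{\Phi \subseteq \mathsf{At}}, (r^{\Phi}_{\Psi})_{\Psi \subseteq \Phi \subseteq \mathsf{At}}, (\Pi^*_i)_{i \in I}, v \rangle$ is an HMS model.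
   Context: Fix a nonempty set $\mathsf{At}$ of atomic formulas. The lattice of spaces: for each $\Phi \subseteq \mathsf{At}$ a nonempty state space $S_\Phi$, pairwise disjoint, ordered by $S_\Psi \preceq S_\Phi$ iff $\Psi \subseteq \Phi$; $\Omega := \bigcup_\Phi S_\Phi$; surjections $r^\Phi_\Psi : S_\Phi \to S_\Psi$ for $\Psi \subseteq \Phi$ with $r^\Phi_\Phi$ the identity and $r^\Phi_\Upsilon = r^\Psi_\Upsilon \circ r^\Phi_\Psi$ for $\Upsilon \subseteq \Psi \subseteq \Phi$. Notation: $\omega_\Psi := r^\Phi_\Psi(\omega)$; $D_\Psi := r^\Phi_\Psi(D)$ for $D \subseteq S_\Phi$, and $D_S := D_\Psi$ for $S = S_\Psi$; $S_\omega$ the space containing $\omega$; $D^{\uparrow} := \bigcup_{\Phi \subseteq \Psi \subseteq \mathsf{At}} (r^\Psi_\Phi)^{ -1}(D)$ for $D \subseteq S_\Phi$; an event is a set $D^\uparrow$ (with base-space $S_\Phi$, distinct vacuous events $\emptyset^{S_\Phi}$ for each $\Phi$). An HMS model $\langle I, \{S_\Phi\}, (r^\Phi_\Psi), (\Pi_i)_{i \in I}, v\rangle$ has a nonempty set $I$, the lattice, a valuation $v$ from atoms to events, and maps $\Pi_i : \Omega \to 2^\Omega \setminus\{\emptyset\}$ satisfying (writing $\Pi_i^\uparrow(\omega) := (\Pi_i(\omega))^\uparrow$, and $S_{\Pi_i(\omega)}$ for the space containing $\Pi_i(\omega)$): Confinement (if $\omega \in S_\Phi$ then $\Pi_i(\omega)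 \subseteq S_\Psi$ for some $\Psi \subseteq \Phi$); Generalized Reflexivity ($\omega \in \Pi_i^\uparrow(\omega)$); Stationarity ($\omega' \in \Pi_i(\omega) \Rightarrow \Pi_i(\omega') = \Pi_i(\omega)$); Projections Preserve Ignorance ($\omega \in S_\Phi$, $\Psi \subseteq \Phi \Rightarrow \Pi_i^\uparrow(\omega) \subseteq \Pi_i^\uparrow(\omega_\Psi)$); Projections Preserve Knowledge ($\Upsilon \subseteq \Psi \subseteq \Phi$, $\omega \in S_\Phi$, $\Pi_i(\omega) \subseteq S_\Psi \Rightarrow (\Pi_i(\omega))_\Upsilon = \Pi_i(\omega_\Upsilon)$). A complemented HMS model additionally has maps $\Lambda_i : \Omega \to 2^\Omega$ with Reflexivity ($\omega \in \Lambda_i(\omega)$), Stationarity ($\omega' \in \Lambda_i(\omega) \Rightarrow \Lambda_i(\omega') = \Lambda_i(\omega)$), Projections Preserve Implicit Knowledge ($\omega \in S_\Phi \Rightarrow \Lambda_i(\omega)_\Psi = \Lambda_i(\omega_\Psi)$ for all $\Psi \subseteq \Phi$), Explicit Measurability ($\omega' \in \Lambda_i(\omega) \Rightarrow \Pi_i(\omega') = \Pi_i(\omega)$), Implicit Measurability ($\omega' \in \Pi_i(\omega) \Rightarrow \Lambda_i(\omega') = \Lambda_i(\omega)_{S_{\Pi_i(\omega)}}$). An implicit knowledge-based HMS model $\langle I, \{S_\Phi\}, (r^\Phi_\Psi), (\Lambda^*_i), (\alpha_i), v\rangle$ has the lattice, a valuation, maps $\Lambda^*_i : \Omega \to 2^\Omega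 \setminus \{\emptyset\}$ satisfying Reflexivity, Stationarity and Projections Preserve Implicit Knowledge, and awareness functions $\alpha_i : \Omega \to \{S_\Phi\}_{\Phi \subseteq \mathsf{At}}$ satisfying: O. if $\omega \in S_\Phi$ then $\alpha_i(\omega) \preceq S_\Phi$; I. if $\omega' \in \Lambda^*_i(\omega)$ then $\alpha_i(\omega') = \alpha_i(\omega)$; II. if $\omega \in S_\Phi$ and $S_\Psi \preceq \alpha_i(\omega)$ then $\alpha_i(\omega_\Psi) = S_\Psi$; III. if $\omega \in S_\Phi$ and $\alpha_i(\omega) \preceq S_\Psi \preceq S_\Phi$ then $\alpha_i(\omega_\Psi) = \alpha_i(\omega)$; IV. if $\omega \in S_\Phi$ and $\Psi \subseteq \Phi$ then $\alpha_i(\omega) \succeq \alpha_i(\omega_\Psi)$. The derived explicit possibility correspondence is $\Pi^*_i(\omega_\Phi) := \Lambda^*_i(\omega)_{\alpha_i(\omega_\Phi)}$ for all $\omega \in \Omega$ and $\Phi$ with $S_\Phi \preceq S_\omega$. -}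

module Defs where

open import Level using (0ℓ)
open import Data.Product using (Σ; ∃; _×_; _,_)
open import Relation.Unary using (Pred; _⊆_; _≐_; Satisfiable; _∈_)
open import Relation.Binary.PropositionalEquality using (_≡_)

Sub : Set → Set₁
Sub At = Pred At 0ℓ

-- The union Ω of all spaces is a type; every state
-- ω lies in exactly one space, namely S_(sp ω).  Hence S_Φ = {ω | sp ω = Φ}
-- (equality of subsets is extensional, ≐), and the spaces are automatically
-- pairwise disjoint.  The ordering S_Ψ ⪯ S_Φ is Ψ ⊆ Φ.
-- r Ψ ω is ω_Ψ = r^Φ_Ψ(ω) for ω ∈ S_Φ (only meaningful when Ψ ⊆ sp ω).
record Lattice (At : Set) : Set₁ where
  field
    Ω  : Set
    sp : Ω → Sub At
    r  : Sub At → Ω → Ω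

  S : Sub At → Pred Ω 0ℓ
  S Φ ω = sp ω ≐ Φ

  field
    nonempty : ∀ (Φ : Sub At) → Satisfiable (S Φ)
    r-space  : ∀ {Ψ ω} → Ψ ⊆ sp ω → sp (r Ψ ω) ≐ Ψ
    r-ext    : ∀ {Ψ Ψ′ ω} → Ψ ≐ Ψ′ → Ψ ⊆ sp ω → r Ψ ω ≡ r Ψ′ ω
    r-id     : ∀ {ω} → r (sp ω) ω ≡ ω
    r-comp   : ∀ {Υ Ψ ω} → Υ ⊆ Ψ → Ψ ⊆ sp ω → r Υ (r Ψ ω) ≡ r Υ ω
    r-surj   : ∀ {Φ Ψ ω′} → Ψ ⊆ Φ → ω′ ∈ S Ψ →
               ∃ λ ω → ω ∈ S Φ × r Ψ ω ≡ ω′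

  _↓_ : Pred Ω 0ℓ → Sub At → Pred Ω 0ℓ
  (D ↓ Ψ) ω′ = ∃ λ ω → ω ∈ D × r Ψ ω ≡ ω′

  up : Pred Ω 0ℓ → Pred Ω (Level.suc 0ℓ)
  up D ω′ = Σ (Sub At) λ Ψ → D ⊆ S Ψ × Ψ ⊆ sp ω′ × r Ψ ω′ ∈ D

-- An event D^↑ is given by its base space S_Φ and base set D ⊆ S_Φ.
Event : {At : Set} → Lattice At → Set₁
Event {At} L = Σ (Sub At) λ Φ → Σ (Pred Ω 0ℓ) λ D → D ⊆ S Φ
  where open Lattice L

module _ {At : Set} (L : Lattice At) where
  open Lattice L

  record IsHMS (I : Set) (v : At → Event L) (Π : I → Ω → Pred Ω 0ℓ) : Set₁ where
    field
      Π-nonempty      : ∀ i ω → Satisfiable (Π i ω)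
      confinement     : ∀ i ω → ∃ λ (Ψ : Sub At) → Ψ ⊆ sp ω × Π i ω ⊆ S Ψ
      gen-reflexivity : ∀ i ω → ω ∈ up (Π i ω)
      stationarity    : ∀ i {ω ω′} → ω′ ∈ Π i ω → Π i ω′ ≐ Π i ω
      proj-pres-ignorance :
        ∀ i {ω} {Ψ : Sub At} → Ψ ⊆ sp ω → up (Π i ω) ⊆ up (Π i (r Ψ ω))
      proj-pres-knowledge :
        ∀ i {ω} {Ψ Υ : Sub At} → Υ ⊆ Ψ → Ψ ⊆ sp ω → Π i ω ⊆ S Ψ →
        (Π i ω ↓ Υ) ≐ Π i (r Υ ω)

  record IsComplementedHMS (I : Set) (v : At → Event L)
           (Λ : I → Ω → Pred Ω 0ℓ) (Π : I → Ω → Pred Ω 0ℓ) : Set₁ where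
    field
      isHMS          : IsHMS I v Π
      -- Λ_i(ω) ⊆ S_ω: presupposed by the notation Λ_i(ω)_Ψ
      Λ-confined     : ∀ i ω → Λ i ω ⊆ S (sp ω)
      Λ-reflexivity  : ∀ i ω → ω ∈ Λ i ω
      Λ-stationarity : ∀ i {ω ω′} → ω′ ∈ Λ i ω → Λ i ω′ ≐ Λ i ω
      proj-pres-implicit-knowledge :
        ∀ i {ω} {Ψ : Sub At} → Ψ ⊆ sp ω → (Λ i ω ↓ Ψ) ≐ Λ i (r Ψ ω)
      explicit-measurability : ∀ i {ω ω′} → ω′ ∈ Λ i ω → Π i ω′ ≐ Π i ω
      -- S_{Π_i(ω)} = S_Ψ means Π_i(ω) ⊆ S_Ψ
      implicit-measurability :
        ∀ i {ω ω′} {Ψ : Sub At} → ω′ ∈ Π i ω → Π i ω ⊆ S Ψ →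
        Λ i ω′ ≐ (Λ i ω ↓ Ψ)

  -- ⟨I, {S_Φ}, (r^Φ_Ψ), (Λ*_i), (α_i), v⟩ is an implicit knowledge-based HMS model
  -- (α_i(ω) = S_(α i ω))
  record IsImplicitKnowledgeBasedHMS (I : Set) (v : At → Event L)
           (Λ : I → Ω → Pred Ω 0ℓ) (α : I → Ω → Sub At) : Set₁ where
    field
      Λ-nonempty     : ∀ i ω → Satisfiable (Λ i ω)
      -- Λ*_i(ω) ⊆ S_ω: presupposed by the notation Λ*_i(ω)_Ψ
      Λ-confined     : ∀ i ω → Λ i ω ⊆ S (sp ω)
      Λ-reflexivity  : ∀ i ω → ω ∈ Λ i ω
      Λ-stationarity : ∀ i {ω ω′} → ω′ ∈ Λ i ω → Λ i ω′ ≐ Λ i ω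
      proj-pres-implicit-knowledge :
        ∀ i {ω} {Ψ : Sub At} → Ψ ⊆ sp ω → (Λ i ω ↓ Ψ) ≐ Λ i (r Ψ ω)
      awareness-O   : ∀ i ω → α i ω ⊆ sp ω
      awareness-I   : ∀ i {ω ω′} → ω′ ∈ Λ i ω → α i ω′ ≐ α i ω
      awareness-II  : ∀ i {ω} {Ψ : Sub At} → Ψ ⊆ α i ω → α i (r Ψ ω) ≐ Ψ
      awareness-III : ∀ i {ω} {Ψ : Sub At} → α i ω ⊆ Ψ → Ψ ⊆ sp ω →
                      α i (r Ψ ω) ≐ α i ω
      awareness-IV  : ∀ i {ω} {Ψ : Sub At} → Ψ ⊆ sp ω → α i (r Ψ ω) ⊆ α i ω

  -- derived explicit possibility correspondence Π*_i(ω) := Λ*_i(ω)_{α_i(ω)}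
  -- (the paper's definition instantiated with ω_Φ := ω, Φ the space of ω)
  derivedΠ : {I : Set} → (I → Ω → Pred Ω 0ℓ) → (I → Ω → Sub At) →
             I → Ω → Pred Ω 0ℓ
  derivedΠ Λ α i ω = Λ i ω ↓ α i ω

{-# OPTIONS --safe #-}
module Submission where

-- Π*_i(ω) = Λ*_i(ω)_{α_i(ω)} lies in the space α_i(ω), and by awareness
-- axioms I and II together with Projections Preserve Implicit Knowledge every
-- state of Π*_i(ω) has awareness α_i(ω) and implicit possibility set
-- Λ*_i(ω)_{α_i(ω)}. Stationarity, both measurability conditions and
-- Projections Preserve Knowledge then reduce to the fact that projecting to Ψ
-- and then to Υ ⊆ Ψ is projecting to Υ. For Projections Preserve Ignorance,
-- the witness in Λ*_i(ω) of a state above Π*_i(ω) projects to a witness in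
-- Λ*_i(ω_Ψ), since by axiom IV the awareness α_i(ω_Ψ) lies below α_i(ω).

open import Defs
open import Level using (0ℓ)
open import Function using (_∘_; id)
open import Data.Product using (_×_; _,_; proj₁; proj₂)
open import Relation.Unary using (Pred; _⊆_; _≐_; _∈_; Satisfiable)
open import Relation.Unary.Properties using (≐-sym; ≐-trans)
open import Relation.Unary.Relation.Binary.Equality using (≐-setoid)
open import Relation.Binary.PropositionalEquality using (_≡_; refl; sym; trans; cong; module ≡-Reasoning)
import Relation.Binary.Reasoning.Setoid as SetoidReasoning

module Projection {At : Set} (L : Lattice At) where
  open Lattice L

  module ≐-Reasoning = SetoidReasoning (≐-setoid Ω 0ℓ)

  LiesAbove : Pred Ω 0ℓ → Sub At → Set
  LiesAbove D Ψ = ∀ {ω} → ω ∈ D → Ψ ⊆ sp ω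

  ↓-space : ∀ {D Ψ} → LiesAbove D Ψ → (D ↓ Ψ) ⊆ S Ψ
  ↓-space D≥Ψ (ω , ω∈D , refl) = r-space (D≥Ψ ω∈D)

  ↓-congˡ : ∀ {D D′ Ψ} → D ≐ D′ → (D ↓ Ψ) ≐ (D′ ↓ Ψ)
  ↓-congˡ (D⊆D′ , D′⊆D) =
    (λ (ω , ω∈D , eq) → ω , D⊆D′ ω∈D , eq) ,
    (λ (ω , ω∈D′ , eq) → ω , D′⊆D ω∈D′ , eq)

  ↓-congʳ : ∀ {D Ψ Ψ′} → LiesAbove D Ψ → Ψ ≐ Ψ′ → (D ↓ Ψ) ≐ (D ↓ Ψ′)
  ↓-congʳ D≥Ψ Ψ≐Ψ′ =
    (λ (ω , ω∈D , eq) → ω , ω∈D , trans (sym (r-ext Ψ≐Ψ′ (D≥Ψ ω∈D))) eq) ,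
    (λ (ω , ω∈D , eq) → ω , ω∈D , trans (r-ext Ψ≐Ψ′ (D≥Ψ ω∈D)) eq)

  ↓-↓ : ∀ {D Ψ Υ} → Υ ⊆ Ψ → LiesAbove D Ψ → ((D ↓ Ψ) ↓ Υ) ≐ (D ↓ Υ)
  ↓-↓ Υ⊆Ψ D≥Ψ =
    (λ { (_ , (ω , ω∈D , refl) , refl) → ω , ω∈D , sym (r-comp Υ⊆Ψ (D≥Ψ ω∈D)) }) ,
    (λ { (ω , ω∈D , refl) → _ , (ω , ω∈D , refl) , r-comp Υ⊆Ψ (D≥Ψ ω∈D) })

  ↓-idem : ∀ {D Ψ} → LiesAbove D Ψ → ((D ↓ Ψ) ↓ Ψ) ≐ (D ↓ Ψ)
  ↓-idem = ↓-↓ id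

module DerivedPossibility {At : Set} {L : Lattice At} {I : Set} {v : At → Event L}
  {Λ : I → Lattice.Ω L → Pred (Lattice.Ω L) 0ℓ} {α : I → Lattice.Ω L → Sub At}
  (M : IsImplicitKnowledgeBasedHMS L I v Λ α) where
  open Lattice L
  open Projection L
  open IsImplicitKnowledgeBasedHMS M

  Π : I → Ω → Pred Ω 0ℓ
  Π = derivedΠ L Λ α

  Λ-liesAbove : ∀ i {ω Ψ} → Ψ ⊆ sp ω → LiesAbove (Λ i ω) Ψ
  Λ-liesAbove i {ω} Ψ⊆ω ω′∈Λ = proj₂ (Λ-confined i ω ω′∈Λ) ∘ Ψ⊆ω

  Λ-liesAbove-α : ∀ i ω → LiesAbove (Λ i ω) (α i ω)
  Λ-liesAbove-α i ω = Λ-liesAbove i (awareness-O i ω)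

  Π-space : ∀ i ω → Π i ω ⊆ S (α i ω)
  Π-space i ω = ↓-space (Λ-liesAbove-α i ω)

  Π-space-unique : ∀ i {ω ω′ Ψ} → ω′ ∈ Π i ω → Π i ω ⊆ S Ψ → Ψ ≐ α i ω
  Π-space-unique i {ω} ω′∈Π Π⊆S = ≐-trans (≐-sym (Π⊆S ω′∈Π)) (Π-space i ω ω′∈Π)

  Π-nonempty : ∀ i ω → Satisfiable (Π i ω)
  Π-nonempty i ω = let (ω′ , ω′∈Λ) = Λ-nonempty i ω in _ , ω′ , ω′∈Λ , refl

  Π-gen-reflexivity : ∀ i ω → ω ∈ up (Π i ω)
  Π-gen-reflexivity i ω =
    α i ω , Π-space i ω , awareness-O i ω , ω , Λ-reflexivity i ω , refl

  α-on-Π : ∀ i {ω ω′} → ω′ ∈ Π i ω → α i ω′ ≐ α i ω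
  α-on-Π i (_ , ω″∈Λ , refl) = awareness-II i (proj₂ (awareness-I i ω″∈Λ))

  Λ-on-Π : ∀ i {ω ω′} → ω′ ∈ Π i ω → Λ i ω′ ≐ (Λ i ω ↓ α i ω)
  Λ-on-Π i {ω} (ω″ , ω″∈Λ , refl) = begin
    Λ i (r (α i ω) ω″)  ≈⟨ ≐-sym (proj-pres-implicit-knowledge i α⊆ω″) ⟩
    (Λ i ω″ ↓ α i ω)    ≈⟨ ↓-congˡ (Λ-stationarity i ω″∈Λ) ⟩
    (Λ i ω ↓ α i ω)     ∎
    where
    open ≐-Reasoning
    α⊆ω″ = Λ-liesAbove-α i ω ω″∈Λ

  Π-stationarity : ∀ i {ω ω′} → ω′ ∈ Π i ω → Π i ω′ ≐ Π i ω
  Π-stationarity i {ω} {ω′} ω′∈Π = begin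
    (Λ i ω′ ↓ α i ω′)            ≈⟨ ↓-congʳ (Λ-liesAbove-α i ω′) (α-on-Π i ω′∈Π) ⟩
    (Λ i ω′ ↓ α i ω)             ≈⟨ ↓-congˡ (Λ-on-Π i ω′∈Π) ⟩
    ((Λ i ω ↓ α i ω) ↓ α i ω)    ≈⟨ ↓-idem (Λ-liesAbove-α i ω) ⟩
    (Λ i ω ↓ α i ω)              ∎
    where open ≐-Reasoning

  Π-explicit-measurability : ∀ i {ω ω′} → ω′ ∈ Λ i ω → Π i ω′ ≐ Π i ω
  Π-explicit-measurability i {ω} {ω′} ω′∈Λ = begin
    (Λ i ω′ ↓ α i ω′)  ≈⟨ ↓-congˡ (Λ-stationarity i ω′∈Λ) ⟩
    (Λ i ω ↓ α i ω′)   ≈⟨ ≐-sym (↓-congʳ (Λ-liesAbove-α i ω)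
                                          (≐-sym (awareness-I i ω′∈Λ))) ⟩
    (Λ i ω ↓ α i ω)    ∎
    where open ≐-Reasoning

  Π-implicit-measurability : ∀ i {ω ω′ Ψ} → ω′ ∈ Π i ω → Π i ω ⊆ S Ψ →
                             Λ i ω′ ≐ (Λ i ω ↓ Ψ)
  Π-implicit-measurability i {ω} ω′∈Π Π⊆S =
    ≐-trans (Λ-on-Π i ω′∈Π)
            (↓-congʳ (Λ-liesAbove-α i ω) (≐-sym (Π-space-unique i ω′∈Π Π⊆S)))

  Π-proj-pres-knowledge : ∀ i {ω Ψ Υ} → Υ ⊆ Ψ → Ψ ⊆ sp ω → Π i ω ⊆ S Ψ →
                          (Π i ω ↓ Υ) ≐ Π i (r Υ ω)
  Π-proj-pres-knowledge i {ω} {Ψ} {Υ} Υ⊆Ψ Ψ⊆ω Π⊆S = begin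
    ((Λ i ω ↓ α i ω) ↓ Υ)  ≈⟨ ↓-↓ Υ⊆α (Λ-liesAbove-α i ω) ⟩
    (Λ i ω ↓ Υ)            ≈⟨ ≐-sym (↓-idem (Λ-liesAbove i Υ⊆ω)) ⟩
    ((Λ i ω ↓ Υ) ↓ Υ)      ≈⟨ ↓-congˡ (proj-pres-implicit-knowledge i Υ⊆ω) ⟩
    (Λ i ωΥ ↓ Υ)           ≈⟨ ↓-congʳ (Λ-liesAbove i (proj₂ (r-space Υ⊆ω)))
                                       (≐-sym (awareness-II i Υ⊆α)) ⟩
    (Λ i ωΥ ↓ α i ωΥ)      ∎
    where
    open ≐-Reasoning
    ωΥ = r Υ ω
    Υ⊆ω : Υ ⊆ sp ω
    Υ⊆ω = Ψ⊆ω ∘ Υ⊆Ψ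
    Υ⊆α : Υ ⊆ α i ω
    Υ⊆α = proj₁ (Π-space-unique i (proj₂ (Π-nonempty i ω)) Π⊆S) ∘ Υ⊆Ψ

  Π-proj-pres-ignorance : ∀ i {ω Ψ} → Ψ ⊆ sp ω → up (Π i ω) ⊆ up (Π i (r Ψ ω))
  Π-proj-pres-ignorance i {ω} {Ψ} Ψ⊆ω {ω′}
    (Ψ′ , Π⊆S , Ψ′⊆ω′ , ω′Ψ′∈Π@(ω″ , ω″∈Λ , ω″α≡ω′Ψ′)) =
    α₁ , Π-space i (r Ψ ω) , Ψ′⊆ω′ ∘ α⊆Ψ′ ∘ α₁⊆α ,
    r Ψ ω″ , proj₁ (proj-pres-implicit-knowledge i Ψ⊆ω) (ω″ , ω″∈Λ , refl) ,
    same-projection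
    where
    open ≡-Reasoning
    α₁ = α i (r Ψ ω)
    α₁⊆α : α₁ ⊆ α i ω
    α₁⊆α = awareness-IV i Ψ⊆ω
    α₁⊆Ψ : α₁ ⊆ Ψ
    α₁⊆Ψ = proj₁ (r-space Ψ⊆ω) ∘ awareness-O i (r Ψ ω)
    α⊆Ψ′ : α i ω ⊆ Ψ′
    α⊆Ψ′ = proj₂ (Π-space-unique i ω′Ψ′∈Π Π⊆S)
    same-projection : r α₁ (r Ψ ω″) ≡ r α₁ ω′
    same-projection = begin
      r α₁ (r Ψ ω″)        ≡⟨ r-comp α₁⊆Ψ (Λ-liesAbove i Ψ⊆ω ω″∈Λ) ⟩
      r α₁ ω″              ≡⟨ r-comp α₁⊆α (Λ-liesAbove-α i ω ω″∈Λ) ⟨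
      r α₁ (r (α i ω) ω″)  ≡⟨ cong (r α₁) ω″α≡ω′Ψ′ ⟩
      r α₁ (r Ψ′ ω′)       ≡⟨ r-comp (α⊆Ψ′ ∘ α₁⊆α) Ψ′⊆ω′ ⟩
      r α₁ ω′              ∎

  isHMS : IsHMS L I v Π
  isHMS = record
    { Π-nonempty          = Π-nonempty
    ; confinement         = λ i ω → α i ω , awareness-O i ω , Π-space i ω
    ; gen-reflexivity     = Π-gen-reflexivity
    ; stationarity        = Π-stationarity
    ; proj-pres-ignorance = Π-proj-pres-ignorance
    ; proj-pres-knowledge = Π-proj-pres-knowledge
    }

  isComplementedHMS : IsComplementedHMS L I v Λ Π
  isComplementedHMS = record
    { isHMS                        = isHMS
    ; Λ-confined                   = Λ-confined
    ; Λ-reflexivity                = Λ-reflexivity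
    ; Λ-stationarity               = Λ-stationarity
    ; proj-pres-implicit-knowledge = proj-pres-implicit-knowledge
    ; explicit-measurability       = Π-explicit-measurability
    ; implicit-measurability       = Π-implicit-measurability
    }

corollary1 : {At : Set} → At → (L : Lattice At) → (I : Set) → I →
    (v : At → Event L) →
    (Λ : I → Lattice.Ω L → Pred (Lattice.Ω L) 0ℓ) →
    (α : I → Lattice.Ω L → Sub At) →
    IsImplicitKnowledgeBasedHMS L I v Λ α →
    IsComplementedHMS L I v Λ (derivedΠ L Λ α) × IsHMS L I v (derivedΠ L Λ α)
corollary1 _ _ _ _ _ _ _ M = isComplementedHMS , isHMS
  where open DerivedPossibility M
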